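{- Fix integers $d,m,n\geq 2$, a proper divisor $\ell\geq1$ of $n$, and a $d$-th root of unity $\zeta\neq1$. Let $C_{d,m,\ell}=d^{\ell}\big(\prod_{i=0}^{\ell-1}a_{m-1+i}\big)^{d-1}\in\mathbb{Z}[c]$, let $\alpha_0$ be a root of $B_1=a_{m+\ell-1}-\zeta a_{m-1}$, and put $C=\zeta^{d-1}C_{d,m,\ell}(\alpha_0)$. Then for every $j\geq1$, $b_j(\alpha_0)=1+C+\cdots+C^{j-1}$.
   Context: For an integer $d\geq 2$ define polynomials $a_i\in\mathbb{Z}[c]$ by $a_1=c$, $a_{i+1}=a_i^d+c$, with $a_0=0$. For the fixed $m,\ell,\zeta$, set $B_j=a_{m+\ell j-1}-\zeta a_{m-1}\in\mathbb{Z}[\zeta,c]$ for $j\geq1$ and $b_j=B_j/B_1$; each $b_j$ is a polynomial in $\mathbb{Z}[\zeta,c]$. -}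

module Defs where

open import Level using (Level)
open import Algebra.Bundles using (CommutativeRing)
open import Data.Nat as ℕ using (ℕ; zero; suc)
open import Data.List using (List; []; _∷_; map)
open import Relation.Binary.PropositionalEquality using (_≡_)

-- Univariate polynomials in the variable c over a commutative ring R,
-- represented by their (ascending) coefficient lists.
module Poly {a r : Level} (R : CommutativeRing a r) where
  open CommutativeRing R

  Pol : Set a
  Pol = List Carrier

  coeff : Pol → ℕ → Carrier
  coeff []       _       = 0#
  coeff (x ∷ p)  zero    = x
  coeff (x ∷ p)  (suc k) = coeff p k

  _≈ₚ_ : Pol → Pol → Set r
  p ≈ₚ q = ∀ k → coeff p k ≈ coeff q k

  _+ₚ_ : Pol → Pol → Pol
  []      +ₚ q       = q
  (x ∷ p) +ₚ []      = x ∷ p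
  (x ∷ p) +ₚ (y ∷ q) = (x + y) ∷ (p +ₚ q)

  -ₚ_ : Pol → Pol
  -ₚ p = map (-_) p

  _-ₚ_ : Pol → Pol → Pol
  p -ₚ q = p +ₚ (-ₚ q)

  _·ₚ_ : Carrier → Pol → Pol
  x ·ₚ p = map (x *_) p

  _*ₚ_ : Pol → Pol → Pol
  []      *ₚ q = []
  (x ∷ p) *ₚ q = (x ·ₚ q) +ₚ (0# ∷ (p *ₚ q))

  1ₚ : Pol
  1ₚ = 1# ∷ []

  Xₚ : Pol
  Xₚ = 0# ∷ 1# ∷ []

  _^ₚ_ : Pol → ℕ → Pol
  p ^ₚ zero  = 1ₚ
  p ^ₚ suc n = p *ₚ (p ^ₚ n)

  prodₚ : ℕ → (ℕ → Pol) → Pol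
  prodₚ zero    f = 1ₚ
  prodₚ (suc k) f = prodₚ k f *ₚ f k

  eval : Pol → Carrier → Carrier
  eval []      x = 0#
  eval (y ∷ p) x = y + x * eval p x

  _^ᴿ_ : Carrier → ℕ → Carrier
  x ^ᴿ zero  = 1#
  x ^ᴿ suc n = x * (x ^ᴿ n)

  fromℕ : ℕ → Carrier
  fromℕ zero    = 0#
  fromℕ (suc n) = 1# + fromℕ n

  geom : Carrier → ℕ → Carrier
  geom C zero    = 0#
  geom C (suc j) = geom C j + C ^ᴿ j

  aₚ : ℕ → ℕ → Pol
  aₚ d zero    = []
  aₚ d (suc i) = (aₚ d i ^ₚ d) +ₚ Xₚ

  Bₚ : ℕ → ℕ → ℕ → Carrier → ℕ → Pol
  Bₚ d m l ζ j = aₚ d (m ℕ.+ l ℕ.* j ℕ.∸ 1) -ₚ (ζ ·ₚ aₚ d (m ℕ.∸ 1))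

  Cₚ : ℕ → ℕ → ℕ → Pol
  Cₚ d m l = fromℕ (d ℕ.^ l) ·ₚ (prodₚ l (λ i → aₚ d (m ℕ.∸ 1 ℕ.+ i)) ^ₚ (d ℕ.∸ 1))

{-# OPTIONS --safe #-}
-- Since a (i+1) − a (k+1) = a i ^ d − a k ^ d and ζ ^ d = 1, the difference
-- a (N + ℓ) − a (M + ℓ) telescopes into (a N − ζ a M) times ℓ factors of the form
-- Φ x y = (x ^ d − y ^ d) / (x − y).  For N = m − 1 + ℓ j and M = m − 1 this reads
-- B (j+1) = B 1 + B j · G j, so B (j+1) = B 1 · q j with q 0 = 1, q j = 1 + q (j−1) · G j.
-- At a root α₀ of B 1 we have a (m−1+ℓ) = ζ a (m−1), so the orbits of a (m−1+ℓ j) and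
-- a (m−1) merge after one step; every factor of G j is then evaluated on the diagonal,
-- Φ x x = d x ^ (d−1), and G j (α₀) = C.  As B 1 is monic, the quotient of B j by B 1
-- is unique and evaluates to 1 + C + ⋯ + C ^ (j−1).
module Submission where

open import Defs
open import Level using (Level)
open import Algebra.Bundles using (CommutativeRing)
open import Data.Nat using (ℕ; _≤_; _<_; _∸_)
open import Data.Nat.Divisibility using (_∣_)
open import Data.Product using (Σ; _×_)
open import Relation.Nullary using (¬_)

open import Data.Nat as ℕ using (zero; suc; z≤n; s≤s)
import Data.Nat.Properties as ℕ
open import Data.List using ([]; _∷_; length)
open import Data.Product using (_,_)
open import Data.Sum using (_⊎_; inj₁; inj₂)
open import Relation.Binary.PropositionalEquality as ≡ using (_≡_)
import Relation.Binary.Reasoning.Setoid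

module CommutativeRingFacts {c ℓ : Level} (S : CommutativeRing c ℓ) where
  open CommutativeRing S
  open import Algebra.Properties.CommutativeSemiring.Exp commutativeSemiring public
    using (_^_; ^-congˡ; ^-distrib-*)
  open import Algebra.Properties.Semiring.Mult semiring
    using (×1-homo-*) renaming (_×_ to _×ᴿ_)
  open Poly S using (fromℕ)
  open import Algebra.Properties.Ring ring using (-‿distribˡ-*; -‿distribʳ-*)
  open import Algebra.Properties.AbelianGroup +-abelianGroup using (⁻¹-∙-comm)
  open import Algebra.Properties.Group +-group using (⁻¹-involutive)
  open import Algebra.Properties.CommutativeSemigroup +-commutativeSemigroup
    using (interchange)
  open import Algebra.Properties.CommutativeSemigroup *-commutativeSemigroup
    using () renaming (x∙yz≈y∙xz to *-swap; interchange to *-interchange)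
  open import Relation.Binary.Reasoning.Setoid setoid

  [x+z]-[y+z]≈x-y : ∀ x y z → (x + z) + - (y + z) ≈ x + - y
  [x+z]-[y+z]≈x-y x y z = begin
    (x + z) + - (y + z)   ≈⟨ +-congˡ (⁻¹-∙-comm y z) ⟨
    (x + z) + (- y + - z) ≈⟨ interchange _ _ _ _ ⟩
    (x + - y) + (z + - z) ≈⟨ +-congˡ (-‿inverseʳ z) ⟩
    (x + - y) + 0#        ≈⟨ +-identityʳ _ ⟩
    x + - y               ∎

  [x-z]-[y-z]≈x-y : ∀ x y z → (x + - z) + - (y + - z) ≈ x + - y
  [x-z]-[y-z]≈x-y x y z = begin
    (x + - z) + - (y + - z) ≈⟨ +-congˡ (⁻¹-∙-comm y (- z)) ⟨
    (x + - z) + (- y + - - z) ≈⟨ +-congˡ (+-congˡ (⁻¹-involutive z)) ⟩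
    (x + - z) + (- y + z)   ≈⟨ interchange _ _ _ _ ⟩
    (x + - y) + (- z + z)   ≈⟨ +-congˡ (-‿inverseˡ z) ⟩
    (x + - y) + 0#          ≈⟨ +-identityʳ _ ⟩
    x + - y                 ∎

  [x-y]+[y-z]≈x-z : ∀ x y z → (x + - y) + (y + - z) ≈ x + - z
  [x-y]+[y-z]≈x-z x y z = begin
    (x + - y) + (y + - z) ≈⟨ +-assoc _ _ _ ⟩
    x + (- y + (y + - z)) ≈⟨ +-congˡ (+-assoc _ _ _) ⟨
    x + ((- y + y) + - z) ≈⟨ +-congˡ (+-congʳ (-‿inverseˡ y)) ⟩
    x + (0# + - z)        ≈⟨ +-congˡ (+-identityˡ _) ⟩
    x + - z               ∎

  x-y≈z⇒x≈y+z : ∀ {x y z} → x + - y ≈ z → x ≈ y + z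
  x-y≈z⇒x≈y+z {x} {y} {z} x-y≈z = begin
    x              ≈⟨ +-identityʳ x ⟨
    x + 0#         ≈⟨ +-congˡ (-‿inverseˡ y) ⟨
    x + (- y + y)  ≈⟨ +-assoc _ _ _ ⟨
    (x + - y) + y  ≈⟨ +-congʳ x-y≈z ⟩
    z + y          ≈⟨ +-comm _ _ ⟩
    y + z          ∎

  Φ : ℕ → Carrier → Carrier → Carrier
  Φ zero    x y = 0#
  Φ (suc n) x y = x ^ n + y * Φ n x y

  Φ-cong : ∀ n {x x′ y y′} → x ≈ x′ → y ≈ y′ → Φ n x y ≈ Φ n x′ y′
  Φ-cong zero    x≈x′ y≈y′ = refl
  Φ-cong (suc n) x≈x′ y≈y′ = +-cong (^-congˡ n x≈x′) (*-cong y≈y′ (Φ-cong n x≈x′ y≈y′))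

  x^n-y^n≈[x-y]Φ : ∀ n x y → x ^ n + - y ^ n ≈ (x + - y) * Φ n x y
  x^n-y^n≈[x-y]Φ zero    x y = trans (-‿inverseʳ 1#) (sym (zeroʳ _))
  x^n-y^n≈[x-y]Φ (suc n) x y = sym (begin
    (x + - y) * (x ^ n + y * Φ n x y)
      ≈⟨ distribˡ _ _ _ ⟩
    (x + - y) * x ^ n + (x + - y) * (y * Φ n x y)
      ≈⟨ +-cong (distribʳ _ _ _) (*-swap _ _ _) ⟩
    (x * x ^ n + - y * x ^ n) + y * ((x + - y) * Φ n x y)
      ≈⟨ +-cong (+-congˡ (-‿distribˡ-* _ _)) (*-congˡ (x^n-y^n≈[x-y]Φ n x y)) ⟨
    (x * x ^ n + - (y * x ^ n)) + y * (x ^ n + - y ^ n)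
      ≈⟨ +-congˡ (trans (distribˡ _ _ _) (+-congˡ (sym (-‿distribʳ-* _ _)))) ⟩
    (x * x ^ n + - (y * x ^ n)) + (y * x ^ n + - (y * y ^ n))
      ≈⟨ [x-y]+[y-z]≈x-z _ _ _ ⟩
    x * x ^ n + - (y * y ^ n) ∎)

  Φ-diagonal : ∀ n x → Φ n x x ≈ fromℕ n * x ^ (n ∸ 1)
  Φ-diagonal zero          x = sym (zeroˡ _)
  Φ-diagonal (suc zero)    x = begin
    1# + x * 0#   ≈⟨ +-congˡ (zeroʳ x) ⟩
    1# + 0#       ≈⟨ *-identityʳ _ ⟨
    (1# + 0#) * 1# ∎
  Φ-diagonal (suc (suc n)) x = begin
    x ^ suc n + x * Φ (suc n) x x        ≈⟨ +-congˡ (*-congˡ (Φ-diagonal (suc n) x)) ⟩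
    x ^ suc n + x * (fromℕ (suc n) * x ^ n) ≈⟨ +-cong (*-identityˡ _) (*-swap _ _ _) ⟨
    1# * x ^ suc n + fromℕ (suc n) * x ^ suc n ≈⟨ distribʳ _ _ _ ⟨
    fromℕ (suc (suc n)) * x ^ suc n      ∎

  ∏ : ℕ → (ℕ → Carrier) → Carrier
  ∏ zero    f = 1#
  ∏ (suc k) f = ∏ k f * f k

  ∏-cong : ∀ k {f g} → (∀ i → f i ≈ g i) → ∏ k f ≈ ∏ k g
  ∏-cong zero    f≈g = refl
  ∏-cong (suc k) f≈g = *-cong (∏-cong k f≈g) (f≈g k)

  ∏-distrib-* : ∀ k f g → ∏ k (λ i → f i * g i) ≈ ∏ k f * ∏ k g
  ∏-distrib-* zero    f g = sym (*-identityˡ 1#)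
  ∏-distrib-* (suc k) f g = trans (*-congʳ (∏-distrib-* k f g)) (*-interchange _ _ _ _)

  ∏-const : ∀ k x → ∏ k (λ _ → x) ≈ x ^ k
  ∏-const zero    x = refl
  ∏-const (suc k) x = trans (*-congʳ (∏-const k x)) (*-comm _ _)

  ∏-^ : ∀ k f n → ∏ k (λ i → f i ^ n) ≈ ∏ k f ^ n
  ∏-^ zero    f n = sym (1^n≈1 n)
    where
    1^n≈1 : ∀ n → 1# ^ n ≈ 1#
    1^n≈1 zero    = refl
    1^n≈1 (suc n) = trans (*-identityˡ _) (1^n≈1 n)
  ∏-^ (suc k) f n = trans (*-congʳ (∏-^ k f n)) (sym (^-distrib-* _ _ n))

  ∏-scaleFirst : ∀ x {f g} → f 0 ≈ x * g 0 → (∀ i → f (suc i) ≈ g (suc i)) →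
                 ∀ k → ∏ (suc k) f ≈ x * ∏ (suc k) g
  ∏-scaleFirst x f0≈xg0 fs≈gs zero    =
    trans (*-identityˡ _) (trans f0≈xg0 (*-congˡ (sym (*-identityˡ _))))
  ∏-scaleFirst x f0≈xg0 fs≈gs (suc k) =
    trans (*-cong (∏-scaleFirst x f0≈xg0 fs≈gs k) (fs≈gs k)) (*-assoc _ _ _)

  fromℕ≡×1 : ∀ n → fromℕ n ≡ n ×ᴿ 1#
  fromℕ≡×1 zero    = ≡.refl
  fromℕ≡×1 (suc n) = ≡.cong (1# +_) (fromℕ≡×1 n)

  fromℕ-^ : ∀ m n → fromℕ (m ℕ.^ n) ≈ fromℕ m ^ n
  fromℕ-^ m zero    = +-identityʳ 1#
  fromℕ-^ m (suc n) = begin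
    fromℕ (m ℕ.* m ℕ.^ n)       ≡⟨ fromℕ≡×1 (m ℕ.* m ℕ.^ n) ⟩
    (m ℕ.* m ℕ.^ n) ×ᴿ 1#       ≈⟨ ×1-homo-* m (m ℕ.^ n) ⟩
    (m ×ᴿ 1#) * ((m ℕ.^ n) ×ᴿ 1#) ≡⟨ ≡.cong₂ _*_ (fromℕ≡×1 m) (fromℕ≡×1 (m ℕ.^ n)) ⟨
    fromℕ m * fromℕ (m ℕ.^ n)   ≈⟨ *-congˡ (fromℕ-^ m n) ⟩
    fromℕ m * fromℕ m ^ n       ∎

module PowerMapOrbits {c ℓ : Level} (S : CommutativeRing c ℓ) where
  open CommutativeRing S
  open CommutativeRingFacts S
  open import Algebra.Properties.Group +-group using (x∙y⁻¹≈ε⇒x≈y)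
  open import Algebra.Properties.CommutativeSemigroup *-commutativeSemigroup
    using () renaming (x∙yz≈y∙xz to *-swap)
  open Poly S using (fromℕ)
  open import Relation.Binary.Reasoning.Setoid setoid

  module Orbit (d : ℕ) (X : Carrier) (A : ℕ → Carrier) (A-suc : ∀ i → A (suc i) ≈ A i ^ d + X)
               (ζ : Carrier) (ζ^d≈1 : ζ ^ d ≈ 1#) where

    [ζx]^d≈x^d : ∀ x → (ζ * x) ^ d ≈ x ^ d
    [ζx]^d≈x^d x = trans (^-distrib-* ζ x d) (trans (*-congʳ ζ^d≈1) (*-identityˡ _))

    A-suc-sub : ∀ N M → A (suc N) + - A (suc M) ≈ (A N + - A M) * Φ d (A N) (A M)
    A-suc-sub N M = begin
      A (suc N) + - A (suc M)         ≈⟨ +-cong (A-suc N) (-‿cong (A-suc M)) ⟩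
      (A N ^ d + X) + - (A M ^ d + X) ≈⟨ [x+z]-[y+z]≈x-y _ _ X ⟩
      A N ^ d + - A M ^ d             ≈⟨ x^n-y^n≈[x-y]Φ d (A N) (A M) ⟩
      (A N + - A M) * Φ d (A N) (A M) ∎

    A-suc-sub-ζ : ∀ N M → A (suc N) + - A (suc M) ≈ (A N + - (ζ * A M)) * Φ d (A N) (ζ * A M)
    A-suc-sub-ζ N M = begin
      A (suc N) + - A (suc M)          ≈⟨ +-cong (A-suc N) (-‿cong (A-suc M)) ⟩
      (A N ^ d + X) + - (A M ^ d + X)  ≈⟨ [x+z]-[y+z]≈x-y _ _ X ⟩
      A N ^ d + - A M ^ d              ≈⟨ +-congˡ (-‿cong ([ζx]^d≈x^d (A M))) ⟨
      A N ^ d + - (ζ * A M) ^ d        ≈⟨ x^n-y^n≈[x-y]Φ d (A N) (ζ * A M) ⟩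
      (A N + - (ζ * A M)) * Φ d (A N) (ζ * A M) ∎

    A-suc-cong : ∀ {N M} → A N ≈ A M → A (suc N) ≈ A (suc M)
    A-suc-cong {N} {M} AN≈AM = trans (A-suc N) (trans (+-congʳ (^-congˡ d AN≈AM)) (sym (A-suc M)))

    A-merge : ∀ {N M} → A N ≈ ζ * A M → ∀ k → A (suc k ℕ.+ N) ≈ A (suc k ℕ.+ M)
    A-merge {N} {M} AN≈ζAM zero    = x∙y⁻¹≈ε⇒x≈y _ _ (begin
      A (suc N) + - A (suc M)                       ≈⟨ A-suc-sub-ζ N M ⟩
      (A N + - (ζ * A M)) * Φ d (A N) (ζ * A M)     ≈⟨ *-congʳ (+-congʳ AN≈ζAM) ⟩
      (ζ * A M + - (ζ * A M)) * Φ d (A N) (ζ * A M) ≈⟨ *-congʳ (-‿inverseʳ _) ⟩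
      0# * Φ d (A N) (ζ * A M)                      ≈⟨ zeroˡ _ ⟩
      0#                                            ∎)
    A-merge AN≈ζAM (suc k) = A-suc-cong (A-merge AN≈ζAM k)

    Q : ℕ → ℕ → ℕ → Carrier
    Q N M zero    = Φ d (A N) (ζ * A M)
    Q N M (suc i) = Φ d (A (suc i ℕ.+ N)) (A (suc i ℕ.+ M))

    A-sub-telescope : ∀ N M k →
      A (suc k ℕ.+ N) + - A (suc k ℕ.+ M) ≈ (A N + - (ζ * A M)) * ∏ (suc k) (Q N M)
    A-sub-telescope N M zero    =
      trans (A-suc-sub-ζ N M) (*-congˡ (sym (*-identityˡ _)))
    A-sub-telescope N M (suc k) = begin
      A (suc (suc k ℕ.+ N)) + - A (suc (suc k ℕ.+ M))
        ≈⟨ A-suc-sub (suc k ℕ.+ N) (suc k ℕ.+ M) ⟩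
      (A (suc k ℕ.+ N) + - A (suc k ℕ.+ M)) * Q N M (suc k)
        ≈⟨ *-congʳ (A-sub-telescope N M k) ⟩
      ((A N + - (ζ * A M)) * ∏ (suc k) (Q N M)) * Q N M (suc k)
        ≈⟨ *-assoc _ _ _ ⟩
      (A N + - (ζ * A M)) * ∏ (suc (suc k)) (Q N M) ∎

    ∏Q-at-period : ∀ {N M} → A N ≈ ζ * A M → ∀ k →
      ∏ (suc k) (Q N M) ≈ ζ ^ (d ∸ 1) * (fromℕ d ^ suc k * ∏ (suc k) (λ i → A (i ℕ.+ M)) ^ (d ∸ 1))
    ∏Q-at-period {N} {M} AN≈ζAM k = begin
      ∏ (suc k) (Q N M)                        ≈⟨ ∏-scaleFirst _ Q₀ Qₛ k ⟩
      ζ ^ (d ∸ 1) * ∏ (suc k) g                ≈⟨ *-congˡ (∏-distrib-* (suc k) _ _) ⟩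
      ζ ^ (d ∸ 1) * (∏ (suc k) (λ _ → fromℕ d) * ∏ (suc k) (λ i → A (i ℕ.+ M) ^ (d ∸ 1)))
        ≈⟨ *-congˡ (*-cong (∏-const (suc k) _) (∏-^ (suc k) _ (d ∸ 1))) ⟩
      ζ ^ (d ∸ 1) * (fromℕ d ^ suc k * ∏ (suc k) (λ i → A (i ℕ.+ M)) ^ (d ∸ 1)) ∎
      where
      g : ℕ → Carrier
      g i = fromℕ d * A (i ℕ.+ M) ^ (d ∸ 1)
      Q₀ : Q N M 0 ≈ ζ ^ (d ∸ 1) * g 0
      Q₀ = begin
        Φ d (A N) (ζ * A M)                   ≈⟨ Φ-cong d AN≈ζAM refl ⟩
        Φ d (ζ * A M) (ζ * A M)               ≈⟨ Φ-diagonal d _ ⟩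
        fromℕ d * (ζ * A M) ^ (d ∸ 1)         ≈⟨ *-congˡ (^-distrib-* ζ (A M) (d ∸ 1)) ⟩
        fromℕ d * (ζ ^ (d ∸ 1) * A M ^ (d ∸ 1)) ≈⟨ *-swap _ _ _ ⟩
        ζ ^ (d ∸ 1) * g 0                     ∎
      Qₛ : ∀ i → Q N M (suc i) ≈ g (suc i)
      Qₛ i = trans (Φ-cong d (A-merge AN≈ζAM i) refl) (Φ-diagonal d _)

module Polynomials {a r : Level} (R : CommutativeRing a r) where
  open CommutativeRing R
  open Poly R
  open import Algebra.Properties.Ring ring using (-0#≈0#)
  open import Algebra.Properties.CommutativeSemigroup +-commutativeSemigroup
    using (interchange; x∙yz≈y∙xz)
  open import Relation.Binary.Reasoning.Setoid setoid

  -- _≈ₚ_ wrapped in a record, so that both polynomials can be inferred from a proof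
  infix 4 _≋_
  record _≋_ (p q : Pol) : Set r where
    constructor mk≋
    field coeff-≈ : p ≈ₚ q
  open _≋_ public

  ≋-refl : ∀ {p} → p ≋ p
  ≋-refl = mk≋ λ k → refl

  ≋-sym : ∀ {p q} → p ≋ q → q ≋ p
  ≋-sym (mk≋ p≈q) = mk≋ λ k → sym (p≈q k)

  ≋-trans : ∀ {p q s} → p ≋ q → q ≋ s → p ≋ s
  ≋-trans (mk≋ p≈q) (mk≋ q≈s) = mk≋ λ k → trans (p≈q k) (q≈s k)

  ≋-reflexive : ∀ {p q} → p ≡ q → p ≋ q
  ≋-reflexive ≡.refl = ≋-refl

  ∷-cong : ∀ {x y p q} → x ≈ y → p ≋ q → (x ∷ p) ≋ (y ∷ q)
  ∷-cong x≈y (mk≋ p≈q) = mk≋ λ { zero → x≈y ; (suc k) → p≈q k }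

  ∷-tail : ∀ {x y p q} → (x ∷ p) ≋ (y ∷ q) → p ≋ q
  ∷-tail (mk≋ eq) = mk≋ λ k → eq (suc k)

  coeff-+ₚ : ∀ p q k → coeff (p +ₚ q) k ≈ coeff p k + coeff q k
  coeff-+ₚ []      q       k       = sym (+-identityˡ _)
  coeff-+ₚ (x ∷ p) []      k       = sym (+-identityʳ _)
  coeff-+ₚ (x ∷ p) (y ∷ q) zero    = refl
  coeff-+ₚ (x ∷ p) (y ∷ q) (suc k) = coeff-+ₚ p q k

  coeff-·ₚ : ∀ x p k → coeff (x ·ₚ p) k ≈ x * coeff p k
  coeff-·ₚ x []      k       = sym (zeroʳ x)
  coeff-·ₚ x (y ∷ p) zero    = refl
  coeff-·ₚ x (y ∷ p) (suc k) = coeff-·ₚ x p k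

  coeff--ₚ : ∀ p k → coeff (-ₚ p) k ≈ - coeff p k
  coeff--ₚ []      k       = sym -0#≈0#
  coeff--ₚ (y ∷ p) zero    = refl
  coeff--ₚ (y ∷ p) (suc k) = coeff--ₚ p k

  +ₚ-cong : ∀ {p p′ q q′} → p ≋ p′ → q ≋ q′ → (p +ₚ q) ≋ (p′ +ₚ q′)
  +ₚ-cong {p} {p′} {q} {q′} (mk≋ p≈p′) (mk≋ q≈q′) = mk≋ λ k →
    trans (coeff-+ₚ p q k) (trans (+-cong (p≈p′ k) (q≈q′ k)) (sym (coeff-+ₚ p′ q′ k)))

  +ₚ-assoc : ∀ p q s → ((p +ₚ q) +ₚ s) ≋ (p +ₚ (q +ₚ s))
  +ₚ-assoc p q s = mk≋ λ k → begin
    coeff ((p +ₚ q) +ₚ s) k             ≈⟨ coeff-+ₚ (p +ₚ q) s k ⟩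
    coeff (p +ₚ q) k + coeff s k        ≈⟨ +-congʳ (coeff-+ₚ p q k) ⟩
    (coeff p k + coeff q k) + coeff s k ≈⟨ +-assoc _ _ _ ⟩
    coeff p k + (coeff q k + coeff s k) ≈⟨ +-congˡ (coeff-+ₚ q s k) ⟨
    coeff p k + coeff (q +ₚ s) k        ≈⟨ coeff-+ₚ p (q +ₚ s) k ⟨
    coeff (p +ₚ (q +ₚ s)) k             ∎

  +ₚ-comm : ∀ p q → (p +ₚ q) ≋ (q +ₚ p)
  +ₚ-comm p q = mk≋ λ k →
    trans (coeff-+ₚ p q k) (trans (+-comm _ _) (sym (coeff-+ₚ q p k)))

  +ₚ-identityʳ : ∀ p → (p +ₚ []) ≋ p
  +ₚ-identityʳ p = mk≋ λ k → trans (coeff-+ₚ p [] k) (+-identityʳ _)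

  +ₚ-interchange : ∀ p q s t → ((p +ₚ q) +ₚ (s +ₚ t)) ≋ ((p +ₚ s) +ₚ (q +ₚ t))
  +ₚ-interchange p q s t = mk≋ λ k → begin
    coeff ((p +ₚ q) +ₚ (s +ₚ t)) k                    ≈⟨ coeff-+ₚ (p +ₚ q) (s +ₚ t) k ⟩
    coeff (p +ₚ q) k + coeff (s +ₚ t) k               ≈⟨ +-cong (coeff-+ₚ p q k) (coeff-+ₚ s t k) ⟩
    (coeff p k + coeff q k) + (coeff s k + coeff t k) ≈⟨ interchange _ _ _ _ ⟩
    (coeff p k + coeff s k) + (coeff q k + coeff t k) ≈⟨ +-cong (coeff-+ₚ p s k) (coeff-+ₚ q t k) ⟨
    coeff (p +ₚ s) k + coeff (q +ₚ t) k               ≈⟨ coeff-+ₚ (p +ₚ s) (q +ₚ t) k ⟨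
    coeff ((p +ₚ s) +ₚ (q +ₚ t)) k                    ∎

  +ₚ-swapˡ : ∀ p q s → (p +ₚ (q +ₚ s)) ≋ (q +ₚ (p +ₚ s))
  +ₚ-swapˡ p q s = mk≋ λ k → begin
    coeff (p +ₚ (q +ₚ s)) k             ≈⟨ coeff-+ₚ p (q +ₚ s) k ⟩
    coeff p k + coeff (q +ₚ s) k        ≈⟨ +-congˡ (coeff-+ₚ q s k) ⟩
    coeff p k + (coeff q k + coeff s k) ≈⟨ x∙yz≈y∙xz _ _ _ ⟩
    coeff q k + (coeff p k + coeff s k) ≈⟨ +-congˡ (coeff-+ₚ p s k) ⟨
    coeff q k + coeff (p +ₚ s) k        ≈⟨ coeff-+ₚ q (p +ₚ s) k ⟨
    coeff (q +ₚ (p +ₚ s)) k             ∎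

  -ₚ-cong : ∀ {p q} → p ≋ q → (-ₚ p) ≋ (-ₚ q)
  -ₚ-cong {p} {q} (mk≋ p≈q) = mk≋ λ k →
    trans (coeff--ₚ p k) (trans (-‿cong (p≈q k)) (sym (coeff--ₚ q k)))

  -ₚ-inverseˡ : ∀ p → ((-ₚ p) +ₚ p) ≋ []
  -ₚ-inverseˡ p = mk≋ λ k →
    trans (coeff-+ₚ (-ₚ p) p k) (trans (+-congʳ (coeff--ₚ p k)) (-‿inverseˡ _))

  -ₚ-inverseʳ : ∀ p → (p +ₚ (-ₚ p)) ≋ []
  -ₚ-inverseʳ p = ≋-trans (+ₚ-comm p (-ₚ p)) (-ₚ-inverseˡ p)

  0∷-≋[] : ∀ {p} → p ≋ [] → (0# ∷ p) ≋ []
  0∷-≋[] (mk≋ p≈0) = mk≋ λ { zero → refl ; (suc k) → p≈0 k }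

  ·ₚ-cong : ∀ {x y p q} → x ≈ y → p ≋ q → (x ·ₚ p) ≋ (y ·ₚ q)
  ·ₚ-cong {x} {y} {p} {q} x≈y (mk≋ p≈q) = mk≋ λ k →
    trans (coeff-·ₚ x p k) (trans (*-cong x≈y (p≈q k)) (sym (coeff-·ₚ y q k)))

  ·ₚ-distribˡ : ∀ x p q → (x ·ₚ (p +ₚ q)) ≋ ((x ·ₚ p) +ₚ (x ·ₚ q))
  ·ₚ-distribˡ x p q = mk≋ λ k → begin
    coeff (x ·ₚ (p +ₚ q)) k               ≈⟨ coeff-·ₚ x (p +ₚ q) k ⟩
    x * coeff (p +ₚ q) k                  ≈⟨ *-congˡ (coeff-+ₚ p q k) ⟩
    x * (coeff p k + coeff q k)           ≈⟨ distribˡ _ _ _ ⟩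
    x * coeff p k + x * coeff q k         ≈⟨ +-cong (coeff-·ₚ x p k) (coeff-·ₚ x q k) ⟨
    coeff (x ·ₚ p) k + coeff (x ·ₚ q) k   ≈⟨ coeff-+ₚ (x ·ₚ p) (x ·ₚ q) k ⟨
    coeff ((x ·ₚ p) +ₚ (x ·ₚ q)) k        ∎

  ·ₚ-distribʳ : ∀ x y p → ((x + y) ·ₚ p) ≋ ((x ·ₚ p) +ₚ (y ·ₚ p))
  ·ₚ-distribʳ x y p = mk≋ λ k → begin
    coeff ((x + y) ·ₚ p) k                ≈⟨ coeff-·ₚ (x + y) p k ⟩
    (x + y) * coeff p k                   ≈⟨ distribʳ _ _ _ ⟩
    x * coeff p k + y * coeff p k         ≈⟨ +-cong (coeff-·ₚ x p k) (coeff-·ₚ y p k) ⟨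
    coeff (x ·ₚ p) k + coeff (y ·ₚ p) k   ≈⟨ coeff-+ₚ (x ·ₚ p) (y ·ₚ p) k ⟨
    coeff ((x ·ₚ p) +ₚ (y ·ₚ p)) k        ∎

  ·ₚ-assoc : ∀ x y p → (x ·ₚ (y ·ₚ p)) ≋ ((x * y) ·ₚ p)
  ·ₚ-assoc x y p = mk≋ λ k → begin
    coeff (x ·ₚ (y ·ₚ p)) k ≈⟨ coeff-·ₚ x (y ·ₚ p) k ⟩
    x * coeff (y ·ₚ p) k    ≈⟨ *-congˡ (coeff-·ₚ y p k) ⟩
    x * (y * coeff p k)     ≈⟨ *-assoc _ _ _ ⟨
    (x * y) * coeff p k     ≈⟨ coeff-·ₚ (x * y) p k ⟨
    coeff ((x * y) ·ₚ p) k  ∎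

  ·ₚ-zeroˡ : ∀ p → (0# ·ₚ p) ≋ []
  ·ₚ-zeroˡ p = mk≋ λ k → trans (coeff-·ₚ 0# p k) (zeroˡ _)

  ·ₚ-identityˡ : ∀ p → (1# ·ₚ p) ≋ p
  ·ₚ-identityˡ p = mk≋ λ k → trans (coeff-·ₚ 1# p k) (*-identityˡ _)

  *ₚ-zeroˡ : ∀ {p} q → p ≋ [] → (p *ₚ q) ≋ []
  *ₚ-zeroˡ {[]}    q p≈0 = ≋-refl
  *ₚ-zeroˡ {x ∷ p} q p≈0 =
    +ₚ-cong {q = 0# ∷ (p *ₚ q)} {q′ = []}
      (≋-trans (·ₚ-cong (coeff-≈ p≈0 0) ≋-refl) (·ₚ-zeroˡ q))
      (0∷-≋[] (*ₚ-zeroˡ {p} q (mk≋ λ k → coeff-≈ p≈0 (suc k))))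

  *ₚ-zeroʳ : ∀ p → (p *ₚ []) ≋ []
  *ₚ-zeroʳ []      = ≋-refl
  *ₚ-zeroʳ (y ∷ p) = 0∷-≋[] (*ₚ-zeroʳ p)

  *ₚ-congʳ : ∀ q {p p′} → p ≋ p′ → (p *ₚ q) ≋ (p′ *ₚ q)
  *ₚ-congʳ q {[]}    {[]}     p≈p′ = ≋-refl
  *ₚ-congʳ q {[]}    {y ∷ p′} p≈p′ = ≋-sym (*ₚ-zeroˡ q (≋-sym p≈p′))
  *ₚ-congʳ q {x ∷ p} {[]}     p≈p′ = *ₚ-zeroˡ q p≈p′
  *ₚ-congʳ q {x ∷ p} {y ∷ p′} p≈p′ =
    +ₚ-cong (·ₚ-cong (coeff-≈ p≈p′ 0) ≋-refl) (∷-cong refl (*ₚ-congʳ q (∷-tail p≈p′)))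

  *ₚ-congˡ : ∀ p {q q′} → q ≋ q′ → (p *ₚ q) ≋ (p *ₚ q′)
  *ₚ-congˡ []      q≈q′ = ≋-refl
  *ₚ-congˡ (x ∷ p) q≈q′ = +ₚ-cong (·ₚ-cong refl q≈q′) (∷-cong refl (*ₚ-congˡ p q≈q′))

  *ₚ-cong : ∀ {p p′ q q′} → p ≋ p′ → q ≋ q′ → (p *ₚ q) ≋ (p′ *ₚ q′)
  *ₚ-cong {p} {p′} {q} p≈p′ q≈q′ = ≋-trans (*ₚ-congʳ q p≈p′) (*ₚ-congˡ p′ q≈q′)

  *ₚ-distribˡ : ∀ p q s → (p *ₚ (q +ₚ s)) ≋ ((p *ₚ q) +ₚ (p *ₚ s))
  *ₚ-distribˡ []      q s = ≋-refl
  *ₚ-distribˡ (x ∷ p) q s =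
    ≋-trans (+ₚ-cong (·ₚ-distribˡ x q s) (∷-cong (sym (+-identityʳ 0#)) (*ₚ-distribˡ p q s)))
            (+ₚ-interchange (x ·ₚ q) (x ·ₚ s) (0# ∷ (p *ₚ q)) (0# ∷ (p *ₚ s)))

  *ₚ-distribʳ : ∀ s p q → ((p +ₚ q) *ₚ s) ≋ ((p *ₚ s) +ₚ (q *ₚ s))
  *ₚ-distribʳ s []      q       = ≋-refl
  *ₚ-distribʳ s (x ∷ p) []      = ≋-sym (+ₚ-identityʳ _)
  *ₚ-distribʳ s (x ∷ p) (y ∷ q) =
    ≋-trans (+ₚ-cong (·ₚ-distribʳ x y s) (∷-cong (sym (+-identityʳ 0#)) (*ₚ-distribʳ s p q)))
            (+ₚ-interchange (x ·ₚ s) (y ·ₚ s) (0# ∷ (p *ₚ s)) (0# ∷ (q *ₚ s)))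

  ·ₚ-*ₚ-assoc : ∀ x q s → ((x ·ₚ q) *ₚ s) ≋ (x ·ₚ (q *ₚ s))
  ·ₚ-*ₚ-assoc x []      s = ≋-refl
  ·ₚ-*ₚ-assoc x (y ∷ q) s =
    ≋-trans (+ₚ-cong (≋-sym (·ₚ-assoc x y s)) (∷-cong (sym (zeroʳ x)) (·ₚ-*ₚ-assoc x q s)))
            (≋-sym (·ₚ-distribˡ x (y ·ₚ s) (0# ∷ (q *ₚ s))))

  0∷-*ₚ : ∀ p s → ((0# ∷ p) *ₚ s) ≋ (0# ∷ (p *ₚ s))
  0∷-*ₚ p s = +ₚ-cong {q = 0# ∷ (p *ₚ s)} (·ₚ-zeroˡ s) ≋-refl

  *ₚ-assoc : ∀ p q s → ((p *ₚ q) *ₚ s) ≋ (p *ₚ (q *ₚ s))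
  *ₚ-assoc []      q s = ≋-refl
  *ₚ-assoc (x ∷ p) q s =
    ≋-trans (*ₚ-distribʳ s (x ·ₚ q) (0# ∷ (p *ₚ q)))
      (+ₚ-cong (·ₚ-*ₚ-assoc x q s)
               (≋-trans (0∷-*ₚ (p *ₚ q) s) (∷-cong refl (*ₚ-assoc p q s))))

  *ₚ-∷ʳ : ∀ q x p → (q *ₚ (x ∷ p)) ≋ ((x ·ₚ q) +ₚ (0# ∷ (q *ₚ p)))
  *ₚ-∷ʳ []      x p = ≋-sym (0∷-≋[] ≋-refl)
  *ₚ-∷ʳ (y ∷ q) x p =
    ∷-cong (+-congʳ (*-comm y x))
      (≋-trans (+ₚ-cong ≋-refl (*ₚ-∷ʳ q x p)) (+ₚ-swapˡ (y ·ₚ p) (x ·ₚ q) (0# ∷ (q *ₚ p))))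

  *ₚ-comm : ∀ p q → (p *ₚ q) ≋ (q *ₚ p)
  *ₚ-comm []      q = ≋-sym (*ₚ-zeroʳ q)
  *ₚ-comm (x ∷ p) q =
    ≋-trans (+ₚ-cong ≋-refl (∷-cong refl (*ₚ-comm p q))) (≋-sym (*ₚ-∷ʳ q x p))

  *ₚ-identityˡ : ∀ p → (1ₚ *ₚ p) ≋ p
  *ₚ-identityˡ p = ≋-trans (+ₚ-cong (·ₚ-identityˡ p) (0∷-≋[] ≋-refl)) (+ₚ-identityʳ p)

  *ₚ-identityʳ : ∀ p → (p *ₚ 1ₚ) ≋ p
  *ₚ-identityʳ p = ≋-trans (*ₚ-comm p 1ₚ) (*ₚ-identityˡ p)

  Pol-commutativeRing : CommutativeRing a r
  Pol-commutativeRing = record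
    { Carrier = Pol ; _≈_ = _≋_ ; _+_ = _+ₚ_ ; _*_ = _*ₚ_ ; -_ = -ₚ_ ; 0# = [] ; 1# = 1ₚ
    ; isCommutativeRing = record
      { isRing = record
        { +-isAbelianGroup = record
          { isGroup = record
            { isMonoid = record
              { isSemigroup = record
                { isMagma = record
                  { isEquivalence = record
                    { refl = λ {p} → ≋-refl {p}
                    ; sym = λ {p} {q} → ≋-sym {p} {q}
                    ; trans = λ {p} {q} {s} → ≋-trans {p} {q} {s} }
                  ; ∙-cong = λ {p} {p′} {q} {q′} → +ₚ-cong {p} {p′} {q} {q′} }
                ; assoc = +ₚ-assoc }
              ; identity = (λ p → ≋-refl {p}) , +ₚ-identityʳ }
            ; inverse = -ₚ-inverseˡ , -ₚ-inverseʳ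
            ; ⁻¹-cong = λ {p} {q} → -ₚ-cong {p} {q} }
          ; comm = +ₚ-comm }
        ; *-cong = λ {p} {p′} {q} {q′} → *ₚ-cong {p} {p′} {q} {q′}
        ; *-assoc = *ₚ-assoc
        ; *-identity = *ₚ-identityˡ , *ₚ-identityʳ
        ; distrib = *ₚ-distribˡ , *ₚ-distribʳ }
      ; *-comm = *ₚ-comm } }

  module P = CommutativeRingFacts Pol-commutativeRing
  module ≋-Reasoning =
    Relation.Binary.Reasoning.Setoid (CommutativeRing.setoid Pol-commutativeRing)
  open CommutativeRingFacts R

  ^ᴿ≡^ : ∀ x n → x ^ᴿ n ≡ x ^ n
  ^ᴿ≡^ x zero    = ≡.refl
  ^ᴿ≡^ x (suc n) = ≡.cong (x *_) (^ᴿ≡^ x n)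

  ^ₚ≡^ : ∀ p n → p ^ₚ n ≡ p P.^ n
  ^ₚ≡^ p zero    = ≡.refl
  ^ₚ≡^ p (suc n) = ≡.cong (p *ₚ_) (^ₚ≡^ p n)

  prodₚ≡∏ : ∀ k f → prodₚ k f ≡ P.∏ k f
  prodₚ≡∏ zero    f = ≡.refl
  prodₚ≡∏ (suc k) f = ≡.cong (_*ₚ f k) (prodₚ≡∏ k f)

  geom-suc : ∀ C n → geom C (suc n) ≈ 1# + geom C n * C
  geom-suc C zero    = begin
    0# + 1#        ≈⟨ +-identityˡ 1# ⟩
    1#             ≈⟨ +-identityʳ 1# ⟨
    1# + 0#        ≈⟨ +-congˡ (zeroˡ C) ⟨
    1# + 0# * C    ∎
  geom-suc C (suc n) = begin
    geom C (suc n) + C ^ᴿ suc n           ≈⟨ +-cong (geom-suc C n) (*-comm C _) ⟩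
    (1# + geom C n * C) + (C ^ᴿ n) * C    ≈⟨ +-assoc _ _ _ ⟩
    1# + (geom C n * C + (C ^ᴿ n) * C)    ≈⟨ +-congˡ (distribʳ _ _ _) ⟨
    1# + geom C (suc n) * C               ∎

  ·ₚ≋const-*ₚ : ∀ x p → (x ·ₚ p) ≋ ((x ∷ []) *ₚ p)
  ·ₚ≋const-*ₚ x p = ≋-sym (≋-trans (+ₚ-cong (≋-refl {x ·ₚ p}) (0∷-≋[] ≋-refl)) (+ₚ-identityʳ _))

  const-^ : ∀ x n → (x ∷ []) P.^ n ≋ (x ^ n ∷ [])
  const-^ x zero    = ≋-refl
  const-^ x (suc n) = ≋-trans (*ₚ-congˡ (x ∷ []) (const-^ x n)) (∷-cong (+-identityʳ _) ≋-refl)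

  record Bounded (K : ℕ) (p : Pol) : Set r where
    constructor vanishFrom
    field vanish : ∀ k → K ≤ k → coeff p k ≈ 0#
  open Bounded

  record Monic (n : ℕ) (p : Pol) : Set r where
    constructor monic
    field
      leading : coeff p n ≈ 1#
      bounded : Bounded (suc n) p
  open Monic

  Bounded-≤ : ∀ {K K′ p} → K ≤ K′ → Bounded K p → Bounded K′ p
  Bounded-≤ K≤K′ bp = vanishFrom λ k K′≤k → vanish bp k (ℕ.≤-trans K≤K′ K′≤k)

  Bounded-tail : ∀ {K x p} → Bounded (suc K) (x ∷ p) → Bounded K p
  Bounded-tail bp = vanishFrom λ k K≤k → vanish bp (suc k) (s≤s K≤k)

  Bounded-0⇒≋[] : ∀ {p} → Bounded 0 p → p ≋ []
  Bounded-0⇒≋[] bp = mk≋ λ k → vanish bp k z≤n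

  Bounded-length : ∀ p → Bounded (length p) p
  Bounded-length []      = vanishFrom λ _ _ → refl
  Bounded-length (x ∷ p) = vanishFrom λ { (suc k) (s≤s le) → vanish (Bounded-length p) k le }

  Bounded-+ₚ : ∀ {K p q} → Bounded K p → Bounded K q → Bounded K (p +ₚ q)
  Bounded-+ₚ {p = p} {q} bp bq = vanishFrom λ k K≤k →
    trans (coeff-+ₚ p q k) (trans (+-cong (vanish bp k K≤k) (vanish bq k K≤k)) (+-identityʳ 0#))

  Bounded-·ₚ : ∀ {K p} x → Bounded K p → Bounded K (x ·ₚ p)
  Bounded-·ₚ {p = p} x bp = vanishFrom λ k K≤k →
    trans (coeff-·ₚ x p k) (trans (*-congˡ (vanish bp k K≤k)) (zeroʳ x))

  Bounded--ₚ : ∀ {K p} → Bounded K p → Bounded K (-ₚ p)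
  Bounded--ₚ {p = p} bp = vanishFrom λ k K≤k →
    trans (coeff--ₚ p k) (trans (-‿cong (vanish bp k K≤k)) -0#≈0#)

  coeff-∷-*ₚ : ∀ x p q k → coeff ((x ∷ p) *ₚ q) k ≈ x * coeff q k + coeff (0# ∷ (p *ₚ q)) k
  coeff-∷-*ₚ x p q k = trans (coeff-+ₚ (x ·ₚ q) (0# ∷ (p *ₚ q)) k) (+-congʳ (coeff-·ₚ x q k))

  Bounded-*ₚ : ∀ {N M p q} → Bounded (suc N) p → Bounded (suc M) q →
               Bounded (suc (N ℕ.+ M)) (p *ₚ q)
  Bounded-*ₚ {p = []}    bp bq = vanishFrom λ _ _ → refl
  Bounded-*ₚ {N} {M} {x ∷ p} {q} bp bq = vanishFrom λ { (suc k) (s≤s N+M≤k) → begin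
    coeff ((x ∷ p) *ₚ q) (suc k)           ≈⟨ coeff-∷-*ₚ x p q (suc k) ⟩
    x * coeff q (suc k) + coeff (p *ₚ q) k ≈⟨ +-cong (x*qₖ≈0 N+M≤k) (pqₖ≈0 N bp N+M≤k) ⟩
    0# + 0#                                ≈⟨ +-identityʳ 0# ⟩
    0#                                     ∎ }
    where
    x*qₖ≈0 : ∀ {k} → N ℕ.+ M ≤ k → x * coeff q (suc k) ≈ 0#
    x*qₖ≈0 {k} N+M≤k =
      trans (*-congˡ (vanish bq (suc k) (s≤s (ℕ.≤-trans (ℕ.m≤n+m M N) N+M≤k)))) (zeroʳ x)
    pqₖ≈0 : ∀ N {k} → Bounded (suc N) (x ∷ p) → N ℕ.+ M ≤ k → coeff (p *ₚ q) k ≈ 0#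
    pqₖ≈0 zero    {k} bp _     = coeff-≈ (*ₚ-zeroˡ q (Bounded-0⇒≋[] (Bounded-tail bp))) k
    pqₖ≈0 (suc N) {k} bp N+M≤k = vanish (Bounded-*ₚ (Bounded-tail bp) bq) k N+M≤k

  coeff-*ₚ-top : ∀ {N M p q} → Bounded (suc N) p → Bounded (suc M) q →
                 coeff (p *ₚ q) (N ℕ.+ M) ≈ coeff p N * coeff q M
  coeff-*ₚ-top {p = []} _ _ = sym (zeroˡ _)
  coeff-*ₚ-top {zero} {M} {x ∷ p} {q} bp bq = begin
    coeff ((x ∷ p) *ₚ q) M                  ≈⟨ coeff-∷-*ₚ x p q M ⟩
    x * coeff q M + coeff (0# ∷ (p *ₚ q)) M ≈⟨ +-congˡ (coeff-≈ 0∷pq≋[] M) ⟩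
    x * coeff q M + 0#                      ≈⟨ +-identityʳ _ ⟩
    x * coeff q M                           ∎
    where
    0∷pq≋[] : (0# ∷ (p *ₚ q)) ≋ []
    0∷pq≋[] = 0∷-≋[] (*ₚ-zeroˡ q (Bounded-0⇒≋[] (Bounded-tail bp)))
  coeff-*ₚ-top {suc N} {M} {x ∷ p} {q} bp bq = begin
    coeff ((x ∷ p) *ₚ q) (suc (N ℕ.+ M))                   ≈⟨ coeff-∷-*ₚ x p q _ ⟩
    x * coeff q (suc (N ℕ.+ M)) + coeff (p *ₚ q) (N ℕ.+ M)
      ≈⟨ +-cong (*-congˡ (vanish bq (suc (N ℕ.+ M)) (s≤s (ℕ.m≤n+m M N))))
                (coeff-*ₚ-top (Bounded-tail bp) bq) ⟩
    x * 0# + coeff p N * coeff q M                         ≈⟨ +-congʳ (zeroʳ x) ⟩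
    0# + coeff p N * coeff q M                             ≈⟨ +-identityˡ _ ⟩
    coeff p N * coeff q M                                  ∎

  Monic-*ₚ : ∀ {N M p q} → Monic N p → Monic M q → Monic (N ℕ.+ M) (p *ₚ q)
  Monic-*ₚ mp mq = monic
    (trans (coeff-*ₚ-top (bounded mp) (bounded mq))
           (trans (*-cong (leading mp) (leading mq)) (*-identityˡ 1#)))
    (Bounded-*ₚ (bounded mp) (bounded mq))

  Monic-^ₚ : ∀ {N p} → Monic N p → ∀ n → Monic (n ℕ.* N) (p ^ₚ n)
  Monic-^ₚ mp zero    = monic refl (vanishFrom λ { (suc k) _ → refl })
  Monic-^ₚ mp (suc n) = Monic-*ₚ mp (Monic-^ₚ mp n)

  Monic-+ₚ : ∀ {N p q} → Monic N p → Bounded N q → Monic N (p +ₚ q)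
  Monic-+ₚ {N} {p} {q} mp bq = monic
    (trans (coeff-+ₚ p q N) (trans (+-cong (leading mp) (vanish bq N ℕ.≤-refl)) (+-identityʳ 1#)))
    (Bounded-+ₚ (bounded mp) (Bounded-≤ (ℕ.n≤1+n N) bq))

  Monic-Xₚ : Monic 1 Xₚ
  Monic-Xₚ = monic refl (vanishFrom λ { (suc (suc k)) _ → refl ; (suc zero) (s≤s ()) })

  Monic-*ₚ-≋[] : ∀ {N p q} → Monic N p → (p *ₚ q) ≋ [] → q ≋ []
  Monic-*ₚ-≋[] {N} {p} {q} mp pq≋[] = Bounded-0⇒≋[] (lower (length q) (Bounded-length q))
    where
    lowerByOne : ∀ K → Bounded (suc K) q → Bounded K q
    lowerByOne K bq = vanishFrom λ k K≤k → qₖ≈0 k K≤k (ℕ.m≤n⇒m<n∨m≡n K≤k)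
      where
      qₖ≈0 : ∀ k → K ≤ k → suc K ≤ k ⊎ K ≡ k → coeff q k ≈ 0#
      qₖ≈0 k _ (inj₁ K<k)    = vanish bq k K<k
      qₖ≈0 k _ (inj₂ ≡.refl) = begin
        coeff q K                ≈⟨ *-identityˡ _ ⟨
        1# * coeff q K           ≈⟨ *-congʳ (leading mp) ⟨
        coeff p N * coeff q K    ≈⟨ coeff-*ₚ-top (bounded mp) bq ⟨
        coeff (p *ₚ q) (N ℕ.+ K) ≈⟨ coeff-≈ pq≋[] (N ℕ.+ K) ⟩
        0#                       ∎
    lower : ∀ K → Bounded K q → Bounded 0 q
    lower zero    bq = bq
    lower (suc K) bq = lower K (lowerByOne K bq)

  Monic-*ₚ-cancelˡ : ∀ {N p q s} → Monic N p → (p *ₚ q) ≋ (p *ₚ s) → q ≋ s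
  Monic-*ₚ-cancelˡ {p = p} {q} {s} mp pq≋ps =
    x∙y⁻¹≈ε⇒x≈y q s (Monic-*ₚ-≋[] mp (≋-trans (x[y-z]≈xy-xz p q s) (x≈y⇒x∙y⁻¹≈ε pq≋ps)))
    where
    open import Algebra.Properties.Ring (CommutativeRing.ring Pol-commutativeRing)
      using (x[y-z]≈xy-xz)
    open import Algebra.Properties.Group (CommutativeRing.+-group Pol-commutativeRing)
      using (x∙y⁻¹≈ε⇒x≈y; x≈y⇒x∙y⁻¹≈ε)

  module Evaluation (α : Carrier) where
    open import Algebra.Properties.Ring ring using (-‿distribʳ-*)
    open import Algebra.Properties.AbelianGroup +-abelianGroup using (⁻¹-∙-comm)
    open import Algebra.Properties.CommutativeSemigroup *-commutativeSemigroup
      using () renaming (x∙yz≈y∙xz to *-swap)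

    eval-+ₚ : ∀ p q → eval (p +ₚ q) α ≈ eval p α + eval q α
    eval-+ₚ []      q       = sym (+-identityˡ _)
    eval-+ₚ (y ∷ p) []      = sym (+-identityʳ _)
    eval-+ₚ (y ∷ p) (z ∷ q) = begin
      (y + z) + α * eval (p +ₚ q) α             ≈⟨ +-congˡ (*-congˡ (eval-+ₚ p q)) ⟩
      (y + z) + α * (eval p α + eval q α)       ≈⟨ +-congˡ (distribˡ _ _ _) ⟩
      (y + z) + (α * eval p α + α * eval q α)   ≈⟨ interchange _ _ _ _ ⟩
      (y + α * eval p α) + (z + α * eval q α)   ∎

    eval-·ₚ : ∀ x p → eval (x ·ₚ p) α ≈ x * eval p α
    eval-·ₚ x []      = sym (zeroʳ x)
    eval-·ₚ x (y ∷ p) = begin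
      x * y + α * eval (x ·ₚ p) α ≈⟨ +-congˡ (*-congˡ (eval-·ₚ x p)) ⟩
      x * y + α * (x * eval p α)  ≈⟨ +-congˡ (*-swap _ _ _) ⟩
      x * y + x * (α * eval p α)  ≈⟨ distribˡ _ _ _ ⟨
      x * (y + α * eval p α)      ∎

    eval--ₚ : ∀ p → eval (-ₚ p) α ≈ - eval p α
    eval--ₚ []      = sym -0#≈0#
    eval--ₚ (y ∷ p) = begin
      - y + α * eval (-ₚ p) α ≈⟨ +-congˡ (*-congˡ (eval--ₚ p)) ⟩
      - y + α * - eval p α    ≈⟨ +-congˡ (-‿distribʳ-* _ _) ⟨
      - y + - (α * eval p α)  ≈⟨ ⁻¹-∙-comm _ _ ⟩
      - (y + α * eval p α)    ∎

    eval-*ₚ : ∀ p q → eval (p *ₚ q) α ≈ eval p α * eval q α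
    eval-*ₚ []      q = sym (zeroˡ _)
    eval-*ₚ (y ∷ p) q = begin
      eval ((y ·ₚ q) +ₚ (0# ∷ (p *ₚ q))) α        ≈⟨ eval-+ₚ (y ·ₚ q) (0# ∷ (p *ₚ q)) ⟩
      eval (y ·ₚ q) α + (0# + α * eval (p *ₚ q) α) ≈⟨ +-cong (eval-·ₚ y q) (+-identityˡ _) ⟩
      y * eval q α + α * eval (p *ₚ q) α          ≈⟨ +-congˡ (*-congˡ (eval-*ₚ p q)) ⟩
      y * eval q α + α * (eval p α * eval q α)    ≈⟨ +-congˡ (*-assoc _ _ _) ⟨
      y * eval q α + (α * eval p α) * eval q α    ≈⟨ distribʳ _ _ _ ⟨
      (y + α * eval p α) * eval q α               ∎

    eval-const : ∀ x → eval (x ∷ []) α ≈ x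
    eval-const x = trans (+-congˡ (zeroʳ α)) (+-identityʳ x)

    eval-Xₚ : eval Xₚ α ≈ α
    eval-Xₚ = trans (+-identityˡ _) (trans (*-congˡ (eval-const 1#)) (*-identityʳ α))

    eval-cong : ∀ {p q} → p ≋ q → eval p α ≈ eval q α
    eval-cong {p} {q} (mk≋ p≈q) = go p q p≈q
      where
      eval-≈[] : ∀ p → p ≈ₚ [] → eval p α ≈ 0#
      eval-≈[] []      _   = refl
      eval-≈[] (y ∷ p) p≈0 = begin
        y + α * eval p α ≈⟨ +-cong (p≈0 0) (*-congˡ (eval-≈[] p λ k → p≈0 (suc k))) ⟩
        0# + α * 0#      ≈⟨ +-identityˡ _ ⟩
        α * 0#           ≈⟨ zeroʳ α ⟩
        0#               ∎
      go : ∀ p q → p ≈ₚ q → eval p α ≈ eval q α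
      go []      q       p≈q = sym (eval-≈[] q λ k → sym (p≈q k))
      go (y ∷ p) []      p≈q = eval-≈[] (y ∷ p) p≈q
      go (y ∷ p) (z ∷ q) p≈q = +-cong (p≈q 0) (*-congˡ (go p q λ k → p≈q (suc k)))

    eval-^ : ∀ p n → eval (p P.^ n) α ≈ eval p α ^ n
    eval-^ p zero    = eval-const 1#
    eval-^ p (suc n) = trans (eval-*ₚ p (p P.^ n)) (*-congˡ (eval-^ p n))

    eval-∏ : ∀ k f → eval (P.∏ k f) α ≈ ∏ k (λ i → eval (f i) α)
    eval-∏ zero    f = eval-const 1#
    eval-∏ (suc k) f = trans (eval-*ₚ (P.∏ k f) (f k)) (*-congʳ (eval-∏ k f))

    eval-Φ : ∀ n p q → eval (P.Φ n p q) α ≈ Φ n (eval p α) (eval q α)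
    eval-Φ zero    p q = refl
    eval-Φ (suc n) p q = begin
      eval ((p P.^ n) +ₚ (q *ₚ P.Φ n p q)) α              ≈⟨ eval-+ₚ (p P.^ n) _ ⟩
      eval (p P.^ n) α + eval (q *ₚ P.Φ n p q) α          ≈⟨ +-cong (eval-^ p n) (eval-*ₚ q _) ⟩
      eval p α ^ n + eval q α * eval (P.Φ n p q) α        ≈⟨ +-congˡ (*-congˡ (eval-Φ n p q)) ⟩
      eval p α ^ n + eval q α * Φ n (eval p α) (eval q α) ∎

module NatIndices where
  open import Data.Nat using (_+_; _*_)
  open import Data.Nat.Tactic.RingSolver using (solve-∀)

  period-shift : ∀ m l j → m + l * suc j ≡ l + (m + l * j)
  period-shift = solve-∀

  one-period : ∀ m l → m + l * 1 ≡ l + m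
  one-period = solve-∀

open NatIndices

module Iterates {a r : Level} (R : CommutativeRing a r) where
  open CommutativeRing R hiding (zero)
  open CommutativeRingFacts R
  open Poly R
  open Polynomials R
  open import Algebra.Properties.Group +-group using (x∙y⁻¹≈ε⇒x≈y)

  module Differences (d : ℕ) (2≤d : 2 ≤ d) (m₁ l′ : ℕ) (ζ : Carrier) (ζ^d≈1 : ζ ^ d ≈ 1#) where

    l : ℕ
    l = suc l′

    A : ℕ → Pol
    A = aₚ d

    -- With m = m₁ + 1 the truncated subtractions in Bₚ compute away: B j reduces to
    -- a (N j) - ζ · a m₁.
    B : ℕ → Pol
    B = Bₚ d (suc m₁) l ζ

    N : ℕ → ℕ
    N j = m₁ ℕ.+ l ℕ.* j

    ζₚ : Pol
    ζₚ = ζ ∷ []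

    A-suc : ∀ i → A (suc i) ≋ ((A i P.^ d) +ₚ Xₚ)
    A-suc i = ≋-reflexive (≡.cong (_+ₚ Xₚ) (^ₚ≡^ (A i) d))

    ζₚ^d≋1 : ζₚ P.^ d ≋ 1ₚ
    ζₚ^d≋1 = ≋-trans (const-^ ζ d) (∷-cong ζ^d≈1 ≋-refl)

    module PolyOrbit = PowerMapOrbits.Orbit Pol-commutativeRing d Xₚ A A-suc ζₚ ζₚ^d≋1

    B≋ : ∀ j → B j ≋ (A (N j) +ₚ (-ₚ (ζₚ *ₚ A m₁)))
    B≋ j = +ₚ-cong ≋-refl (-ₚ-cong (·ₚ≋const-*ₚ ζ (A m₁)))

    G : ℕ → Pol
    G j = P.∏ l (PolyOrbit.Q (N j) m₁)

    B-suc : ∀ j → B (suc (suc j)) ≋ (B 1 +ₚ (B (suc j) *ₚ G (suc j)))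
    B-suc j = P.x-y≈z⇒x≈y+z (begin
      B (suc (suc j)) +ₚ (-ₚ B 1)
        ≈⟨ +ₚ-cong (B≋ (suc (suc j))) (-ₚ-cong (B≋ 1)) ⟩
      (A (N (suc (suc j))) +ₚ (-ₚ (ζₚ *ₚ A m₁))) +ₚ (-ₚ (A (N 1) +ₚ (-ₚ (ζₚ *ₚ A m₁))))
        ≈⟨ P.[x-z]-[y-z]≈x-y (A (N (suc (suc j)))) (A (N 1)) (ζₚ *ₚ A m₁) ⟩
      A (N (suc (suc j))) +ₚ (-ₚ A (N 1))
        ≈⟨ +ₚ-cong (A-≡ (period-shift m₁ l (suc j))) (-ₚ-cong (A-≡ (one-period m₁ l))) ⟩
      A (l ℕ.+ N (suc j)) +ₚ (-ₚ A (l ℕ.+ m₁))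
        ≈⟨ PolyOrbit.A-sub-telescope (N (suc j)) m₁ l′ ⟩
      (A (N (suc j)) +ₚ (-ₚ (ζₚ *ₚ A m₁))) *ₚ G (suc j)
        ≈⟨ *ₚ-congʳ (G (suc j)) (≋-sym (B≋ (suc j))) ⟩
      B (suc j) *ₚ G (suc j) ∎)
      where
      open ≋-Reasoning
      A-≡ : ∀ {i k} → i ≡ k → A i ≋ A k
      A-≡ i≡k = ≋-reflexive (≡.cong A i≡k)

    q : ℕ → Pol
    q zero    = 1ₚ
    q (suc j) = 1ₚ +ₚ (q j *ₚ G (suc j))

    B-divisible : ∀ j → B (suc j) ≋ (B 1 *ₚ q j)
    B-divisible zero    = ≋-sym (*ₚ-identityʳ (B 1))
    B-divisible (suc j) = begin
      B (suc (suc j))                             ≈⟨ B-suc j ⟩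
      B 1 +ₚ (B (suc j) *ₚ G (suc j))             ≈⟨ +ₚ-cong (≋-sym (*ₚ-identityʳ (B 1)))
                                                            (*ₚ-congʳ (G (suc j)) (B-divisible j)) ⟩
      (B 1 *ₚ 1ₚ) +ₚ ((B 1 *ₚ q j) *ₚ G (suc j))  ≈⟨ +ₚ-cong ≋-refl (*ₚ-assoc (B 1) (q j) _) ⟩
      (B 1 *ₚ 1ₚ) +ₚ (B 1 *ₚ (q j *ₚ G (suc j)))  ≈⟨ *ₚ-distribˡ (B 1) 1ₚ (q j *ₚ G (suc j)) ⟨
      B 1 *ₚ q (suc j)                            ∎
      where open ≋-Reasoning

    A-monic : ∀ i → Monic (d ℕ.^ i) (A (suc i))
    A-monic zero    = ≡.subst (λ p → Monic 1 (p +ₚ Xₚ)) (≡.sym ([]^ₚd≡[] (ℕ.<⇒≤ 2≤d))) Monic-Xₚ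
      where
      []^ₚd≡[] : ∀ {n} → 1 ≤ n → [] ^ₚ n ≡ []
      []^ₚd≡[] (s≤s _) = ≡.refl
    A-monic (suc i) =
      Monic-+ₚ (Monic-^ₚ (A-monic i) d) (Bounded-≤ 2≤d^[1+i] (Monic.bounded Monic-Xₚ))
      where
      2≤d^[1+i] : 2 ≤ d ℕ.^ suc i
      2≤d^[1+i] = ℕ.^-monoʳ-< d 2≤d {0} {suc i} (s≤s z≤n)

    A-bounded : ∀ i → Bounded (d ℕ.^ i) (A i)
    A-bounded zero    = vanishFrom λ _ _ → refl
    A-bounded (suc i) = Bounded-≤ (ℕ.^-monoʳ-< d 2≤d (ℕ.n<1+n i)) (Monic.bounded (A-monic i))

    B₁-monic : Monic (d ℕ.^ (l′ ℕ.+ m₁)) (B 1)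
    B₁-monic = Monic-+ₚ A[N₁]-monic
      (Bounded--ₚ (Bounded-·ₚ ζ (Bounded-≤ d^m₁≤d^[l′+m₁] (A-bounded m₁))))
      where
      A[N₁]-monic : Monic (d ℕ.^ (l′ ℕ.+ m₁)) (A (N 1))
      A[N₁]-monic = ≡.subst (λ i → Monic (d ℕ.^ (l′ ℕ.+ m₁)) (A i)) (≡.sym (one-period m₁ l))
                            (A-monic (l′ ℕ.+ m₁))
      d^m₁≤d^[l′+m₁] : d ℕ.^ m₁ ≤ d ℕ.^ (l′ ℕ.+ m₁)
      d^m₁≤d^[l′+m₁] = ℕ.^-monoʳ-≤ d {{ℕ.>-nonZero (ℕ.<-trans (s≤s z≤n) 2≤d)}} (ℕ.m≤n+m m₁ l′)

    module AtRoot (α₀ : Carrier) (B₁[α₀]≈0 : eval (B 1) α₀ ≈ 0#) where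
      open Evaluation α₀
      open import Relation.Binary.Reasoning.Setoid setoid

      v : ℕ → Carrier
      v i = eval (A i) α₀

      v-suc : ∀ i → v (suc i) ≈ v i ^ d + α₀
      v-suc i = begin
        v (suc i)                                 ≈⟨ eval-cong (A-suc i) ⟩
        eval ((A i P.^ d) +ₚ Xₚ) α₀               ≈⟨ eval-+ₚ (A i P.^ d) Xₚ ⟩
        eval (A i P.^ d) α₀ + eval Xₚ α₀          ≈⟨ +-cong (eval-^ (A i) d) eval-Xₚ ⟩
        v i ^ d + α₀                              ∎

      module ValueOrbit = PowerMapOrbits.Orbit R d α₀ v v-suc ζ ζ^d≈1

      v-≡ : ∀ {i k} → i ≡ k → v i ≈ v k
      v-≡ i≡k = reflexive (≡.cong v i≡k)

      v-at-period : ∀ j → v (N (suc j)) ≈ ζ * v m₁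
      v-at-period zero    = x∙y⁻¹≈ε⇒x≈y _ _ (begin
        v (N 1) + - (ζ * v m₁)                          ≈⟨ +-congˡ (-‿cong (eval-·ₚ ζ (A m₁))) ⟨
        v (N 1) + - eval (ζ ·ₚ A m₁) α₀                 ≈⟨ +-congˡ (eval--ₚ (ζ ·ₚ A m₁)) ⟨
        v (N 1) + eval (-ₚ (ζ ·ₚ A m₁)) α₀              ≈⟨ eval-+ₚ (A (N 1)) _ ⟨
        eval (B 1) α₀                                   ≈⟨ B₁[α₀]≈0 ⟩
        0#                                              ∎)
      v-at-period (suc j) = begin
        v (N (suc (suc j)))   ≡⟨ ≡.cong v (period-shift m₁ l (suc j)) ⟩
        v (l ℕ.+ N (suc j))   ≈⟨ ValueOrbit.A-merge (v-at-period j) l′ ⟩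
        v (l ℕ.+ m₁)          ≡⟨ ≡.cong v (one-period m₁ l) ⟨
        v (N 1)               ≈⟨ v-at-period zero ⟩
        ζ * v m₁              ∎

      eval-Q : ∀ M M′ i → eval (PolyOrbit.Q M M′ i) α₀ ≈ ValueOrbit.Q M M′ i
      eval-Q M M′ zero    = trans (eval-Φ d (A M) (ζₚ *ₚ A M′))
        (Φ-cong d refl (trans (eval-*ₚ ζₚ (A M′)) (*-congʳ (eval-const ζ))))
      eval-Q M M′ (suc i) = eval-Φ d _ _

      eval-C : eval (Cₚ d (suc m₁) l) α₀ ≈ fromℕ d ^ l * ∏ l (λ i → v (m₁ ℕ.+ i)) ^ (d ∸ 1)
      eval-C = begin
        eval (fromℕ (d ℕ.^ l) ·ₚ (prodₚ l f ^ₚ (d ∸ 1))) α₀ ≈⟨ eval-·ₚ _ (prodₚ l f ^ₚ (d ∸ 1)) ⟩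
        fromℕ (d ℕ.^ l) * eval (prodₚ l f ^ₚ (d ∸ 1)) α₀
          ≡⟨ ≡.cong (λ p → fromℕ (d ℕ.^ l) * eval p α₀)
                    (≡.trans (^ₚ≡^ (prodₚ l f) (d ∸ 1)) (≡.cong (P._^ (d ∸ 1)) (prodₚ≡∏ l f))) ⟩
        fromℕ (d ℕ.^ l) * eval (P.∏ l f P.^ (d ∸ 1)) α₀
          ≈⟨ *-cong (fromℕ-^ d l)
                    (trans (eval-^ (P.∏ l f) (d ∸ 1)) (^-congˡ (d ∸ 1) (eval-∏ l f))) ⟩
        fromℕ d ^ l * ∏ l (λ i → v (m₁ ℕ.+ i)) ^ (d ∸ 1) ∎
        where
        f : ℕ → Pol
        f i = A (m₁ ℕ.+ i)

      C : Carrier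
      C = ζ ^ᴿ (d ∸ 1) * eval (Cₚ d (suc m₁) l) α₀

      eval-G : ∀ j → eval (G (suc j)) α₀ ≈ C
      eval-G j = begin
        eval (G (suc j)) α₀
          ≈⟨ eval-∏ l _ ⟩
        ∏ l (λ i → eval (PolyOrbit.Q (N (suc j)) m₁ i) α₀)
          ≈⟨ ∏-cong l (eval-Q (N (suc j)) m₁) ⟩
        ∏ l (ValueOrbit.Q (N (suc j)) m₁)
          ≈⟨ ValueOrbit.∏Q-at-period (v-at-period j) l′ ⟩
        ζ ^ (d ∸ 1) * (fromℕ d ^ l * ∏ l (λ i → v (i ℕ.+ m₁)) ^ (d ∸ 1))
          ≈⟨ *-congˡ (*-congˡ (^-congˡ (d ∸ 1) (∏-cong l (λ i → v-≡ (ℕ.+-comm i m₁))))) ⟩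
        ζ ^ (d ∸ 1) * (fromℕ d ^ l * ∏ l (λ i → v (m₁ ℕ.+ i)) ^ (d ∸ 1))
          ≈⟨ *-cong (reflexive (^ᴿ≡^ ζ (d ∸ 1))) eval-C ⟨
        C ∎

      eval-q : ∀ j → eval (q j) α₀ ≈ geom C (suc j)
      eval-q zero    = trans (eval-const 1#) (sym (+-identityˡ 1#))
      eval-q (suc j) = begin
        eval (1ₚ +ₚ (q j *ₚ G (suc j))) α₀            ≈⟨ eval-+ₚ 1ₚ (q j *ₚ G (suc j)) ⟩
        eval 1ₚ α₀ + eval (q j *ₚ G (suc j)) α₀       ≈⟨ +-cong (eval-const 1#) (eval-*ₚ (q j) _) ⟩
        1# + eval (q j) α₀ * eval (G (suc j)) α₀      ≈⟨ +-congˡ (*-cong (eval-q j) (eval-G j)) ⟩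
        1# + geom C (suc j) * C                       ≈⟨ geom-suc C (suc j) ⟨
        geom C (suc (suc j))                          ∎

      eval-quotient : ∀ j b → B (suc j) ≋ (B 1 *ₚ b) → eval b α₀ ≈ geom C (suc j)
      eval-quotient j b B₁₊ⱼ≋B₁b = trans (eval-cong b≋qⱼ) (eval-q j)
        where
        b≋qⱼ : b ≋ q j
        b≋qⱼ = Monic-*ₚ-cancelˡ B₁-monic (≋-trans (≋-sym B₁₊ⱼ≋B₁b) (B-divisible j))

corollary4p2 : ∀ {a r : Level} (R : CommutativeRing a r) →
    let open CommutativeRing R
        open Poly R
    in (d m n l : ℕ) → 2 ≤ d → 2 ≤ m → 2 ≤ n → 1 ≤ l → l ∣ n → l < n →
       (ζ α₀ : Carrier) → ζ ^ᴿ d ≈ 1# → ¬ (ζ ≈ 1#) →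
       eval (Bₚ d m l ζ 1) α₀ ≈ 0# →
       (j : ℕ) → 1 ≤ j →
       Σ Pol (λ q → Bₚ d m l ζ j ≈ₚ (Bₚ d m l ζ 1 *ₚ q))
       × ((b : Pol) → Bₚ d m l ζ j ≈ₚ (Bₚ d m l ζ 1 *ₚ b) →
          eval b α₀ ≈ geom ((ζ ^ᴿ (d ∸ 1)) * eval (Cₚ d m l) α₀) j)
corollary4p2 R d (suc m₁) _ (suc l′) 2≤d (s≤s _) _ (s≤s _) _ _ ζ α₀ ζ^d≈1 _ B₁[α₀]≈0
             (suc j) (s≤s _) =
  (q j , coeff-≈ (B-divisible j)) , λ b B₁₊ⱼ≈B₁b → eval-quotient j b (mk≋ B₁₊ⱼ≈B₁b)
  where
  open CommutativeRing R using (trans; reflexive)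
  open Polynomials R
  open Iterates.Differences R d 2≤d m₁ l′ ζ (trans (reflexive (≡.sym (^ᴿ≡^ ζ d))) ζ^d≈1)
  open AtRoot α₀ B₁[α₀]≈0
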